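{- Let $A,B\subseteq\mathbb{Z}$ be finite nonempty sets with $\min A=\min B=0$, $M=\max A$, $N=\max B$ and $M\geq N$. Let $x\in [0,M]\setminus A$. If $h_A\leq |B|-2$, then either $x\in A+B$ or $x+N\in A+B$.
   Context: For integers $a\le b$, $[a,b]=\{x\in\mathbb{Z}: a\le x\le b\}$. For $X\subseteq \mathbb{Z}$ finite nonempty, $h_X=|[\min X,\max X]\setminus X|$. $A+B=\{a+b:a\in A,b\in B\}$. -}

module Defs where

open import Data.Nat as ℕ using (ℕ; zero; suc)
open import Data.Integer using (ℤ; +_; _+_; _-_; _≤_; ∣_∣)
open import Data.Integer.Properties using (_≟_)
open import Data.List using (List; length; filter; map; upTo)
open import Data.List.Membership.Propositional using (_∈_; _∉_)
open import Data.List.Membership.DecPropositional _≟_ using (_∈?_)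
open import Data.List.Relation.Unary.All using (All)
open import Data.List.Relation.Unary.Unique.Propositional using (Unique)
open import Data.Product using (Σ; _×_; ∃-syntax)
open import Relation.Binary.PropositionalEquality using (_≡_)
open import Relation.Nullary using (¬?)

-- A finite subset of ℤ is represented by a duplicate-free list.
-- m is the minimum / maximum of X
IsMin : List ℤ → ℤ → Set
IsMin X m = m ∈ X × All (m ≤_) X

IsMax : List ℤ → ℤ → Set
IsMax X m = m ∈ X × All (_≤ m) X

intervalFrom : ℤ → ℕ → List ℤ
intervalFrom lo k = map (λ i → lo + + i) (upTo (suc k))

-- number of integers in [lo, hi] not in X (for lo ≤ hi)
gaps : List ℤ → ℤ → ℤ → ℕ
gaps X lo hi = length (filter (λ y → ¬? (y ∈? X)) (intervalFrom lo ∣ hi - lo ∣))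

hOf : List ℤ → (mn mx : ℤ) → ℕ
hOf X mn mx = gaps X mn mx

_∈Sum_+_ : ℤ → List ℤ → List ℤ → Set
z ∈Sum A + B = ∃[ a ] ∃[ b ] (a ∈ A × b ∈ B × z ≡ a + b)

{-# OPTIONS --safe #-}
module Submission where

-- Send each b ∈ B ∖ {0} to x − b if b ≤ x and to x + N − b otherwise. These
-- values lie in [0, M] and are pairwise distinct, so if none of them were in A
-- they would be |B| − 1 gaps of A, contradicting h_A ≤ |B| − 2. A value a ∈ A
-- gives a + b = x or a + b = x + N.

open import Defs
open import Data.Nat as ℕ using (ℕ)
open import Data.Integer using (ℤ; +_; 0ℤ; _+_; _≤_)
open import Data.List using (List; length)
open import Data.List.Membership.Propositional using (_∉_)
open import Data.List.Relation.Unary.Unique.Propositional using (Unique)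
open import Data.Product using (_×_)
open import Data.Sum using (_⊎_)

open import Data.Nat.Properties
  using (+-comm; ≤-trans; ≤-reflexive; m≤n+m; m∸n≤m; m∸n+n≡m; m+n∸m≡n; m+n∸n≡m; ∸-monoʳ-≤; ∸-monoʳ-<; ∸-cancelˡ-≡; ≰⇒>; <⇒≤; <⇒≢; 1+n≰n)
open import Data.Integer as ℤ using (-[1+_]; _-_; -_; ∣_∣; +≤+)
import Data.Integer.Properties as ℤ
open import Data.List using ([]; _∷_; filter)
open import Data.List.Membership.Propositional using (_∈_; find)
open import Data.List.Membership.Propositional.Properties using (∈-filter⁺; ∈-filter⁻; ∈-map⁺; ∈-upTo⁺)
open import Data.List.Membership.DecPropositional ℤ._≟_ using (_∈?_)
open import Data.List.Properties using (filter-notAll; filter-all)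
open import Data.List.Relation.Unary.All as All using (All)
open import Data.List.Relation.Unary.All.Properties using (¬Any⇒All¬)
open import Data.List.Relation.Unary.AllPairs using (_∷_)
open import Data.List.Relation.Unary.Any as Any using (Any; here; there; any?)
open import Data.List.Relation.Unary.Unique.Propositional.Properties as Unique using ()
open import Data.Product using (_,_; proj₁)
open import Data.Sum using (inj₁; inj₂)
open import Data.Empty using (⊥-elim)
open import Relation.Binary.Definitions using (DecidableEquality)
open import Relation.Binary.PropositionalEquality using (_≡_; _≢_; refl; sym; cong; subst; module ≡-Reasoning)
open import Relation.Nullary using (Dec; yes; no; ¬?)

module Pigeonhole {Y : Set} (_≟_ : DecidableEquality Y) where

  length-filter-≢ : ∀ (c : Y) {ys} → Unique ys → length ys ℕ.≤ ℕ.suc (length (filter (λ y → ¬? (y ≟ c)) ys))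
  length-filter-≢ c {[]} _ = ℕ.z≤n
  length-filter-≢ c {y ∷ ys} (y∉ys ∷ uys) with y ≟ c
  ... | yes refl = ℕ.s≤s (≤-reflexive (sym (cong length (filter-all (λ z → ¬? (z ≟ y)) (All.map (λ y≢z z≡y → y≢z (sym z≡y)) y∉ys)))))
  ... | no _ = ℕ.s≤s (length-filter-≢ c uys)

  length-≤-of-injection : {X : Set} (f : X → Y) {xs : List X} {ys : List Y} → Unique xs →
    (∀ {a b} → a ∈ xs → b ∈ xs → f a ≡ f b → a ≡ b) →
    (∀ {a} → a ∈ xs → f a ∈ ys) → length xs ℕ.≤ length ys
  length-≤-of-injection f {[]} _ _ _ = ℕ.z≤n
  length-≤-of-injection f {a ∷ xs} {ys} (a∉xs ∷ uxs) inj into =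
    ≤-trans (ℕ.s≤s (length-≤-of-injection f uxs inj′ into′))
            (filter-notAll ≢fa? ys (Any.map (λ { refl y≢y → y≢y refl }) (into (here refl))))
    where
    ≢fa? = λ y → ¬? (y ≟ f a)
    inj′ : ∀ {b c} → b ∈ xs → c ∈ xs → f b ≡ f c → b ≡ c
    inj′ b∈ c∈ = inj (there b∈) (there c∈)
    into′ : ∀ {b} → b ∈ xs → f b ∈ filter ≢fa? ys
    into′ b∈ = ∈-filter⁺ ≢fa? (into (there b∈)) (λ fb≡fa → All.lookup a∉xs b∈ (inj (here refl) (there b∈) (sym fb≡fa)))

-- hOf X lo hi is definitionally length (gapList X lo hi).
gapList : List ℤ → ℤ → ℤ → List ℤ
gapList X lo hi = filter (λ y → ¬? (y ∈? X)) (intervalFrom lo ∣ hi - lo ∣)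

∉⇒∈-gapList : ∀ {X lo hi y} → lo ≤ y → y ≤ hi → y ∉ X → y ∈ gapList X lo hi
∉⇒∈-gapList {X} {lo} {hi} {y} lo≤y y≤hi y∉X =
  ∈-filter⁺ (λ z → ¬? (z ∈? X)) (subst (_∈ _) lo+offset≡y (∈-map⁺ (λ i → lo + + i) (∈-upTo⁺ (ℕ.s≤s offset≤)))) y∉X
  where
  +offset≡y-lo : + ∣ y - lo ∣ ≡ y - lo
  +offset≡y-lo = ℤ.0≤i⇒+∣i∣≡i (ℤ.i≤j⇒0≤j-i lo≤y)
  lo+offset≡y : lo + + ∣ y - lo ∣ ≡ y
  lo+offset≡y = let open ≡-Reasoning in begin
    lo + + ∣ y - lo ∣  ≡⟨ cong (λ z → lo + z) +offset≡y-lo ⟩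
    lo + (y - lo)      ≡⟨ ℤ.+-comm lo (y - lo) ⟩
    y - lo + lo        ≡⟨ ℤ.+-assoc y (- lo) lo ⟩
    y + (- lo + lo)    ≡⟨ cong (λ z → y + z) (ℤ.+-inverseˡ lo) ⟩
    y + 0ℤ             ≡⟨ ℤ.+-identityʳ y ⟩
    y                  ∎
  offset≤ : ∣ y - lo ∣ ℕ.≤ ∣ hi - lo ∣
  offset≤ = ℤ.drop‿+≤+ (begin
    + ∣ y - lo ∣   ≡⟨ +offset≡y-lo ⟩
    y - lo         ≤⟨ ℤ.+-monoˡ-≤ (- lo) y≤hi ⟩
    hi - lo        ≡⟨ ℤ.0≤i⇒+∣i∣≡i (ℤ.i≤j⇒0≤j-i (ℤ.≤-trans lo≤y y≤hi)) ⟨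
    + ∣ hi - lo ∣  ∎)
    where open ℤ.≤-Reasoning

data _∈[1,_] : ℤ → ℕ → Set where
  pos : ∀ {k N} → 1 ℕ.≤ k → k ℕ.≤ N → (+ k) ∈[1, N ]

≢0⇒∈[1,N] : ∀ {b N} → 0ℤ ≤ b → b ≤ + N → b ≢ 0ℤ → b ∈[1, N ]
≢0⇒∈[1,N] (+≤+ {n = ℕ.zero} _) _ b≢0 = ⊥-elim (b≢0 refl)
≢0⇒∈[1,N] (+≤+ {n = ℕ.suc k} _) (+≤+ 1+k≤N) _ = pos (ℕ.s≤s ℕ.z≤n) 1+k≤N

module Reflection (x N : ℕ) where

  reflect : ℕ → ℕ
  reflect k with k ℕ.≤? x
  ... | yes _ = x ℕ.∸ k
  ... | no _  = x ℕ.+ N ℕ.∸ k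

  private
    ≤x+N : ∀ {k} → k ℕ.≤ N → k ℕ.≤ x ℕ.+ N
    ≤x+N k≤N = ≤-trans k≤N (m≤n+m N x)

    low<high : ∀ {j k} → 1 ℕ.≤ j → j ℕ.≤ x → k ℕ.≤ N → x ℕ.∸ j ℕ.< x ℕ.+ N ℕ.∸ k
    low<high {j} {k} 1≤j j≤x k≤N =
      ≤-trans (∸-monoʳ-< 1≤j j≤x) (≤-trans (≤-reflexive (sym (m+n∸n≡m x N))) (∸-monoʳ-≤ (x ℕ.+ N) k≤N))

  reflect-+ : ∀ {k} → k ℕ.≤ N → reflect k ℕ.+ k ≡ x ⊎ reflect k ℕ.+ k ≡ x ℕ.+ N
  reflect-+ {k} k≤N with k ℕ.≤? x
  ... | yes k≤x = inj₁ (m∸n+n≡m k≤x)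
  ... | no _    = inj₂ (m∸n+n≡m (≤x+N k≤N))

  reflect-≤ : ∀ {k M} → k ℕ.≤ N → x ℕ.≤ M → N ℕ.≤ M → reflect k ℕ.≤ M
  reflect-≤ {k} k≤N x≤M N≤M with k ℕ.≤? x
  ... | yes _   = ≤-trans (m∸n≤m x k) x≤M
  ... | no k≰x  = ≤-trans (∸-monoʳ-≤ (x ℕ.+ N) (<⇒≤ (≰⇒> k≰x))) (≤-trans (≤-reflexive (m+n∸m≡n x N)) N≤M)

  -- Positivity matters: reflect 0 = x = reflect N whenever x < N.
  reflect-injective : ∀ {j k} → 1 ℕ.≤ j → 1 ℕ.≤ k → j ℕ.≤ N → k ℕ.≤ N → reflect j ≡ reflect k → j ≡ k
  reflect-injective {j} {k} 1≤j 1≤k j≤N k≤N eq with j ℕ.≤? x | k ℕ.≤? x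
  ... | yes j≤x | yes k≤x = ∸-cancelˡ-≡ j≤x k≤x eq
  ... | no _    | no _    = ∸-cancelˡ-≡ (≤x+N j≤N) (≤x+N k≤N) eq
  ... | yes j≤x | no _    = ⊥-elim (<⇒≢ (low<high 1≤j j≤x k≤N) eq)
  ... | no _    | yes k≤x = ⊥-elim (<⇒≢ (low<high 1≤k k≤x j≤N) (sym eq))

  reflectℤ : ℤ → ℤ
  reflectℤ (+ k)    = + reflect k
  reflectℤ -[1+ _ ] = 0ℤ

  reflectℤ-injective : ∀ {a b} → a ∈[1, N ] → b ∈[1, N ] → reflectℤ a ≡ reflectℤ b → a ≡ b
  reflectℤ-injective (pos 1≤j j≤N) (pos 1≤k k≤N) eq =
    cong +_ (reflect-injective 1≤j 1≤k j≤N k≤N (ℤ.+-injective eq))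

  reflectℤ-∈-gapList : ∀ {X M b} → x ℕ.≤ M → N ℕ.≤ M → b ∈[1, N ] → reflectℤ b ∉ X → reflectℤ b ∈ gapList X 0ℤ (+ M)
  reflectℤ-∈-gapList x≤M N≤M (pos _ k≤N) = ∉⇒∈-gapList (+≤+ ℕ.z≤n) (+≤+ (reflect-≤ k≤N x≤M N≤M))

  reflectℤ-∈Sum : ∀ {A B b} → b ∈[1, N ] → b ∈ B → reflectℤ b ∈ A → ((+ x) ∈Sum A + B) ⊎ ((+ x + + N) ∈Sum A + B)
  reflectℤ-∈Sum (pos _ k≤N) b∈B r∈A with reflect-+ k≤N
  ... | inj₁ eq = inj₁ (_ , _ , r∈A , b∈B , cong +_ (sym eq))
  ... | inj₂ eq = inj₂ (_ , _ , r∈A , b∈B , cong +_ (sym eq))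

few-gaps-or-∈Sum : (A B : List ℤ) (x N M : ℕ) → Unique B → All (0ℤ ≤_) B → All (_≤ + N) B → x ℕ.≤ M → N ℕ.≤ M →
  length B ℕ.≤ ℕ.suc (hOf A 0ℤ (+ M)) ⊎ ((+ x) ∈Sum A + B) ⊎ ((+ x + + N) ∈Sum A + B)
few-gaps-or-∈Sum A B x N M uB 0≤B B≤N x≤M N≤M = conclude (any? (λ b → reflectℤ b ∈? A) B⁺)
  where
  open Reflection x N
  open Pigeonhole ℤ._≟_
  ≢0? = λ b → ¬? (b ℤ.≟ 0ℤ)
  B⁺ = filter ≢0? B
  ∈B⁺⇒∈[1,N] : ∀ {b} → b ∈ B⁺ → b ∈[1, N ]
  ∈B⁺⇒∈[1,N] b∈B⁺ with b∈B , b≢0 ← ∈-filter⁻ ≢0? b∈B⁺ = ≢0⇒∈[1,N] (All.lookup 0≤B b∈B) (All.lookup B≤N b∈B) b≢0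
  conclude : Dec (Any (λ b → reflectℤ b ∈ A) B⁺) →
    length B ℕ.≤ ℕ.suc (hOf A 0ℤ (+ M)) ⊎ ((+ x) ∈Sum A + B) ⊎ ((+ x + + N) ∈Sum A + B)
  conclude (yes hit) with b , b∈B⁺ , rb∈A ← find hit =
    inj₂ (reflectℤ-∈Sum (∈B⁺⇒∈[1,N] b∈B⁺) (proj₁ (∈-filter⁻ ≢0? b∈B⁺)) rb∈A)
  conclude (no miss) = inj₁ (≤-trans (length-filter-≢ 0ℤ uB)
    (ℕ.s≤s (length-≤-of-injection reflectℤ (Unique.filter⁺ ≢0? uB)
      (λ a∈ b∈ → reflectℤ-injective (∈B⁺⇒∈[1,N] a∈) (∈B⁺⇒∈[1,N] b∈))
      (λ b∈ → reflectℤ-∈-gapList x≤M N≤M (∈B⁺⇒∈[1,N] b∈) (All.lookup (¬Any⇒All¬ B⁺ miss) b∈)))))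

proposition2p4 : (A B : List ℤ) → Unique A → Unique B →
    IsMin A 0ℤ → IsMin B 0ℤ → (M N : ℤ) → IsMax A M → IsMax B N → N ≤ M →
    (x : ℤ) → 0ℤ ≤ x → x ≤ M → x ∉ A →
    hOf A 0ℤ M ℕ.+ 2 ℕ.≤ length B →
    (x ∈Sum A + B) ⊎ ((x + N) ∈Sum A + B)
proposition2p4 _ _ _ _ _ (_ , 0≤B) _ -[1+ _ ] _ (N∈B , _) _ _ _ _ _ _ with () ← All.lookup 0≤B N∈B
proposition2p4 A B _ uB _ (_ , 0≤B) (+ M) (+ N) _ (_ , B≤N) (+≤+ N≤M) (+ x) _ (+≤+ x≤M) _ h+2≤|B|
  with few-gaps-or-∈Sum A B x N M uB 0≤B B≤N x≤M N≤M
... | inj₂ x∈Sum⊎x+N∈Sum = x∈Sum⊎x+N∈Sum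
... | inj₁ |B|≤1+h = ⊥-elim (1+n≰n (≤-trans (≤-reflexive (+-comm 2 h)) (≤-trans h+2≤|B| |B|≤1+h)))
  where h = hOf A 0ℤ (+ M)
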